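{- Let $p$ be any pattern in the symmetry class of one of $(123,\{0\},\{0\})$, $(123,\{0\},\{0,2\})$, $(132,\{0\},\{0\})$, $(132,\{0\},\{0,2\})$. Then for all $n\ge1$, $a_n(p)=n!-(n-1)!+1$.
   Context: A bi-vincular pattern of length $k$ is a triple $p=(\sigma,X,Y)$ with $\sigma$ a permutation of $[k]$ in one-line notation and $X,Y\subseteq\{0,1,\dots,k\}$. A permutation $\pi=\pi_1\cdots\pi_n$ of $[n]$ contains $p$ if there are indices $1\le i_1<\dots<i_k\le n$ such that $(\pi_{i_1},\dots,\pi_{i_k})$ is order-isomorphic to $\sigma$ and, writing $j_1<\dots<j_k$ for the set $\{\pi_{i_1},\dots,\pi_{i_k}\}$ in increasing order and setting $i_0=j_0=0$, $i_{k+1}=j_{k+1}=n+1$, we have $i_{x+1}=i_x+1$ for all $x\in X$ and $j_{y+1}=j_y+1$ for all $y\in Y$. Otherwise $\pi$ avoids $p$; $a_n(p)$ is the number of permutations of $[n]$ avoiding $p$. For $p=(\sigma,X,Y)$ of length $k$ define $p^{i}=(\sigma^{ -1},Y,X)$, $p^{r}=(\sigma^{r},\{k-x:x\in X\},Y)$, $p^{c}=(\sigma^{c},X,\{k-y:y\in Y\})$, with $\sigma^r_m=\sigma_{k+1-m}$ and $\sigma^c_m=k+1-\sigma_m$; the symmetry class of $p$ is the set of patterns obtained from $p$ by finite compositions of $i,r,c$. -}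

module Defs where

open import Data.Nat using (ℕ; zero; suc; _+_; _∸_)
open import Data.Fin using (Fin; zero; suc; toℕ; inject₁; opposite; _<_; _≟_)
open import Data.Fin.Properties using (any?)
open import Data.Fin.Subset using (Subset; _∈_; inside; outside)
open import Data.Vec using (Vec; []; _∷_; lookup; tabulate; reverse; map; _∷ʳ_)
open import Data.Product using (Σ; ∃; _×_; _,_)
open import Data.Sum using (_⊎_)
open import Relation.Binary.PropositionalEquality using (_≡_)
open import Relation.Nullary using (¬_; yes; no)
open import Function.Bundles using (_⇔_)

-- A permutation of [n] in one-line notation: a word of length n over Fin n
-- (value toℕ a stands for a+1) in which every letter occurs exactly once
-- (injective, hence bijective since the word has length n).
IsPerm : ∀ {n} → Vec (Fin n) n → Set
IsPerm {n} w = ∀ (a b : Fin n) → lookup w a ≡ lookup w b → a ≡ b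

-- Bi-vincular pattern (σ, X, Y) of length k; X, Y ⊆ {0,…,k} = Fin (suc k).
record Pattern : Set where
  constructor pat
  field
    len : ℕ
    σ   : Vec (Fin len) len
    X   : Subset (suc len)
    Y   : Subset (suc len)
open Pattern public

inverseWord : ∀ {k} → Vec (Fin k) k → Vec (Fin k) k
inverseWord {k} s = tabulate λ m → pick m (any? (λ a → lookup s a ≟ m))
  where
  pick : ∀ m → _ → Fin k
  pick m (yes (a , _)) = a
  pick m (no _)        = m

_ⁱ : Pattern → Pattern
pat k s x y ⁱ = pat k (inverseWord s) y x

-- σʳ_m = σ_{k+1-m};  X ↦ {k - x}, i.e. the indicator vector reversed
_ʳ : Pattern → Pattern
pat k s x y ʳ = pat k (reverse s) (reverse x) y

-- σᶜ_m = k+1-σ_m;  Y ↦ {k - y}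
_ᶜ : Pattern → Pattern
pat k s x y ᶜ = pat k (map opposite s) x (reverse y)

data InSymClass (p₀ : Pattern) : Pattern → Set where
  base : InSymClass p₀ p₀
  byI  : ∀ {q} → InSymClass p₀ q → InSymClass p₀ (q ⁱ)
  byR  : ∀ {q} → InSymClass p₀ q → InSymClass p₀ (q ʳ)
  byC  : ∀ {q} → InSymClass p₀ q → InSymClass p₀ (q ᶜ)

StrictlyIncreasing : ∀ {k n} → (Fin k → Fin n) → Set
StrictlyIncreasing {k} f = ∀ (a b : Fin k) → a < b → f a < f b

-- 1-indexed extended sequence (0, f₁+1, …, f_k+1, n+1), i.e. (i₀, i₁, …, i_k, i_{k+1})
extended : ∀ {k} (n : ℕ) → (Fin k → Fin n) → Vec ℕ (suc (suc k))
extended n f = 0 ∷ (tabulate (λ a → suc (toℕ (f a))) ∷ʳ suc n)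

Adjacent : ∀ {k} → Subset (suc k) → Vec ℕ (suc (suc k)) → Set
Adjacent {k} Z e = ∀ (x : Fin (suc k)) → x ∈ Z →
  lookup e (suc x) ≡ suc (lookup e (inject₁ x))

Contains : ∀ {n} → Vec (Fin n) n → Pattern → Set
Contains {n} π (pat k s X Y) =
  Σ (Fin k → Fin n) λ i →
    StrictlyIncreasing i ×
    (∀ (a b : Fin k) → (lookup π (i a) < lookup π (i b)) ⇔ (lookup s a < lookup s b)) ×
    -- j = the values {π(i_a)} listed in increasing order
    (Σ (Fin k → Fin n) λ j →
       StrictlyIncreasing j ×
       (∀ a → ∃ λ m → j m ≡ lookup π (i a)) ×
       (∀ m → ∃ λ a → j m ≡ lookup π (i a)) ×
       Adjacent X (extended n i) ×
       Adjacent Y (extended n j))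

Avoids : ∀ {n} → Vec (Fin n) n → Pattern → Set
Avoids π p = ¬ Contains π p

-- "exactly m permutations of [n] avoid p": an enumeration by Fin m that is
-- injective and hits exactly the avoiding permutations.
NumAvoiders : ℕ → Pattern → ℕ → Set
NumAvoiders n p m =
  Σ (Fin m → Vec (Fin n) n) λ f →
    (∀ a → IsPerm (f a) × Avoids (f a) p) ×
    (∀ a b → f a ≡ f b → a ≡ b) ×
    (∀ w → IsPerm w → Avoids w p → ∃ λ a → f a ≡ w)

-- patterns of length 3 (values 0,1,2 stand for 1,2,3)
w123 w132 : Vec (Fin 3) 3
w123 = zero ∷ suc zero ∷ suc (suc zero) ∷ []
w132 = zero ∷ suc (suc zero) ∷ suc zero ∷ []

S0 S02 : Subset 4
S0  = inside ∷ outside ∷ outside ∷ outside ∷ []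
S02 = inside ∷ outside ∷ inside ∷ outside ∷ []

p₁ p₂ p₃ p₄ : Pattern
p₁ = pat 3 w123 S0 S0
p₂ = pat 3 w123 S0 S02
p₃ = pat 3 w132 S0 S0
p₄ = pat 3 w132 S0 S02

module Submission where

-- Every base pattern starts with its minimum and is anchored both at
-- the first position (0 ∈ X) and at the smallest value (0 ∈ Y), so each
-- occurrence uses the letter π(1) = 1: all n! − (n−1)! permutations with
-- π(1) ≠ 1 avoid p.  Among those with π(1) = 1 exactly one avoids p: for
-- σ = 123 it is 1 n (n−1) ⋯ 2, since any other such π has an adjacent ascent
-- after its first letter (adjacent in positions, or in values for the
-- variants with Y = {0,2}); for σ = 132 it is the identity, by the same
-- argument with descents.
--
-- In the code positions and values are 0-based, so π(1) = 1 reads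
-- `lookup π zero ≡ zero`, and the word 1 n (n−1) ⋯ 2 is `flipTailWord`.

open import Defs
open import Data.Nat as ℕ using (ℕ; zero; suc; _+_; _*_; _∸_; _!; s≤s; z≤n)
import Data.Nat.Properties as ℕP
import Data.Bool as Bool
open import Data.Fin
  using (Fin; zero; suc; toℕ; inject₁; opposite; fromℕ; punchIn; punchOut; remQuot; combine; _<_)
import Data.Fin.Properties as FP
open import Data.Fin.Relation.Unary.Top using (view; ‵fromℕ; ‵inject₁)
open import Data.Fin.Subset using (Subset; _∈_)
open import Data.Vec
  using (Vec; []; _∷_; lookup; tabulate; reverse; map; _∷ʳ_; allFin; here; there; head; tail)
open import Data.Vec.Properties
  using (reverse-∷; reverse-involutive; lookup-map; lookup∘tabulate; lookup-allFin; []=⇒lookup; lookup⇒[]=;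
         map-∘; map-cong; map-id; ≡-dec)
open import Data.List using (List; []; _∷_; cartesianProductWith)
open import Data.List.Relation.Unary.All as All using (All; []; _∷_; all?)
open import Data.List.Relation.Unary.Any using (any?; here; there)
open import Data.List.Membership.Propositional using () renaming (_∈_ to _∈ₗ_)
open import Data.List.Membership.Propositional.Properties
  using (∈-cartesianProductWith⁺; ∈-cartesianProductWith⁻)
open import Data.Product using (Σ; ∃; _×_; _,_; proj₁; proj₂)
open import Data.Sum using (_⊎_; inj₁; inj₂)
open import Data.Empty using (⊥-elim)
open import Data.Unit using (tt)
open import Relation.Nullary using (Dec; yes; no; map′)
open import Relation.Nullary.Decidable using (_×-dec_; toWitness)
open import Relation.Binary using (tri<; tri≈; tri>)
open import Relation.Binary.Definitions using (DecidableEquality)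
open import Relation.Binary.PropositionalEquality
open import Function.Bundles using (_⇔_; mk⇔; Equivalence)

private
  variable
    A : Set
    k m n : ℕ

lookup-∷ʳ-inject₁ : (xs : Vec A n) (x : A) (i : Fin n) →
  lookup (xs ∷ʳ x) (inject₁ i) ≡ lookup xs i
lookup-∷ʳ-inject₁ (y ∷ xs) x zero    = refl
lookup-∷ʳ-inject₁ (y ∷ xs) x (suc i) = lookup-∷ʳ-inject₁ xs x i

lookup-∷ʳ-last : (xs : Vec A n) (x : A) → lookup (xs ∷ʳ x) (fromℕ n) ≡ x
lookup-∷ʳ-last []       x = refl
lookup-∷ʳ-last (y ∷ xs) x = lookup-∷ʳ-last xs x

lookup-reverse-opposite : (xs : Vec A n) (i : Fin n) → lookup (reverse xs) (opposite i) ≡ lookup xs i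
lookup-reverse-opposite (x ∷ xs) zero rewrite reverse-∷ x xs = lookup-∷ʳ-last (reverse xs) x
lookup-reverse-opposite (x ∷ xs) (suc i) rewrite reverse-∷ x xs =
  trans (lookup-∷ʳ-inject₁ (reverse xs) x (opposite i)) (lookup-reverse-opposite xs i)

lookup-reverse : (xs : Vec A n) (i : Fin n) → lookup (reverse xs) i ≡ lookup xs (opposite i)
lookup-reverse xs i =
  trans (cong (lookup (reverse xs)) (sym (FP.opposite-involutive i)))
        (lookup-reverse-opposite xs (opposite i))

vec-ext : (xs ys : Vec A n) → (∀ i → lookup xs i ≡ lookup ys i) → xs ≡ ys
vec-ext []       []       _  = refl
vec-ext (x ∷ xs) (y ∷ ys) eq = cong₂ _∷_ (eq zero) (vec-ext xs ys (λ i → eq (suc i)))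

opposite-< : {a b : Fin n} → a < b → opposite b < opposite a
opposite-< {a = a} {b} a<b rewrite FP.opposite-prop a | FP.opposite-prop b =
  ℕP.∸-monoʳ-< (s≤s a<b) (FP.toℕ<n b)

opposite-<⁻ : {a b : Fin n} → opposite b < opposite a → a < b
opposite-<⁻ {a = a} {b} lt =
  subst₂ _<_ (FP.opposite-involutive a) (FP.opposite-involutive b) (opposite-< lt)

opposite-injective : {a b : Fin n} → opposite a ≡ opposite b → a ≡ b
opposite-injective {a = a} {b} eq =
  trans (sym (FP.opposite-involutive a)) (trans (cong opposite eq) (FP.opposite-involutive b))

opposite-inject₁ : (x : Fin k) → opposite (inject₁ x) ≡ suc (opposite x)
opposite-inject₁ {k} x = FP.toℕ-injective (begin
  toℕ (opposite (inject₁ x)) ≡⟨ FP.opposite-prop (inject₁ x) ⟩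
  k ∸ toℕ (inject₁ x)        ≡⟨ cong (k ∸_) (FP.toℕ-inject₁ x) ⟩
  k ∸ toℕ x                  ≡⟨ ℕP.+-∸-assoc 1 (FP.toℕ<n x) ⟩
  suc (k ∸ suc (toℕ x))      ≡⟨ cong suc (FP.opposite-prop x) ⟨
  toℕ (suc (opposite x))     ∎)
  where open ≡-Reasoning

opposite-fromℕ : ∀ k → opposite (fromℕ k) ≡ zero
opposite-fromℕ k = FP.toℕ-injective
  (trans (FP.opposite-prop (fromℕ k)) (trans (cong (k ∸_) (FP.toℕ-fromℕ k)) (ℕP.n∸n≡0 k)))

map-opposite-involutive : (v : Vec (Fin n) k) → map opposite (map opposite v) ≡ v
map-opposite-involutive v =
  trans (sym (map-∘ opposite opposite v)) (trans (map-cong FP.opposite-involutive v) (map-id v))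

-- (2) Reversal and complement preserve the number of avoiders

mirror : (Fin k → Fin n) → Fin k → Fin n
mirror f a = opposite (f (opposite a))

mirror-increasing : (f : Fin k → Fin n) → StrictlyIncreasing f → StrictlyIncreasing (mirror f)
mirror-increasing f inc a b a<b = opposite-< (inc _ _ (opposite-< a<b))

extended-inner : ∀ n (f : Fin k → Fin n) (a : Fin k) →
  lookup (extended n f) (suc (inject₁ a)) ≡ suc (toℕ (f a))
extended-inner n f a =
  trans (lookup-∷ʳ-inject₁ (tabulate λ b → suc (toℕ (f b))) (suc n) a) (lookup∘tabulate _ a)

extended-last : ∀ n (f : Fin k → Fin n) → lookup (extended n f) (suc (fromℕ k)) ≡ suc n
extended-last n f = lookup-∷ʳ-last (tabulate λ b → suc (toℕ (f b))) (suc n)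

extended-mirror : ∀ n (f : Fin k → Fin n) (t : Fin (suc (suc k))) →
  lookup (extended n (mirror f)) t + lookup (extended n f) (opposite t) ≡ suc n
extended-mirror {k} n f zero = extended-last n f
extended-mirror {k} n f (suc t) with view t
... | ‵fromℕ rewrite opposite-fromℕ k =
  trans (cong (_+ 0) (extended-last n (mirror f))) (ℕP.+-identityʳ (suc n))
... | ‵inject₁ a = begin
  lookup (extended n (mirror f)) (suc (inject₁ a)) + lookup (extended n f) (inject₁ (opposite (inject₁ a)))
    ≡⟨ cong₂ _+_ (extended-inner n (mirror f) a)
                 (cong (λ z → lookup (extended n f) (inject₁ z)) (opposite-inject₁ a)) ⟩
  suc (toℕ (opposite v)) + lookup (extended n f) (suc (inject₁ (opposite a)))
    ≡⟨ cong₂ (λ x y → suc x + y) (FP.opposite-prop v) (extended-inner n f (opposite a)) ⟩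
  suc (n ∸ suc (toℕ v)) + suc (toℕ v)
    ≡⟨ cong suc (ℕP.m∸n+n≡m (FP.toℕ<n v)) ⟩
  suc n ∎
  where
  open ≡-Reasoning
  v = f (opposite a)

adjacent-mirror : ∀ n (f : Fin k → Fin n) (Z : Subset (suc k)) →
  Adjacent Z (extended n f) → Adjacent (reverse Z) (extended n (mirror f))
adjacent-mirror {k} n f Z adj x x∈ = ℕP.+-cancelʳ-≡ (lookup e (suc y)) _ _ (begin
  lookup e′ (suc x) + lookup e (suc y)            ≡⟨ cong (lookup e′ (suc x) +_) (adj y y∈Z) ⟩
  lookup e′ (suc x) + suc (lookup e (inject₁ y))  ≡⟨ ℕP.+-suc _ _ ⟩
  suc (lookup e′ (suc x) + lookup e (inject₁ y))  ≡⟨ cong suc (extended-mirror n f (suc x)) ⟩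
  suc (suc n)                                     ≡⟨ cong suc (extended-mirror n f (inject₁ x)) ⟨
  suc (lookup e′ (inject₁ x) + lookup e (opposite (inject₁ x)))
    ≡⟨ cong (λ z → suc (lookup e′ (inject₁ x) + lookup e z)) (opposite-inject₁ x) ⟩
  suc (lookup e′ (inject₁ x)) + lookup e (suc y)  ∎)
  where
  open ≡-Reasoning
  e = extended n f
  e′ = extended n (mirror f)
  y = opposite x
  y∈Z : y ∈ Z
  y∈Z = lookup⇒[]= y Z (trans (sym (lookup-reverse Z x)) ([]=⇒lookup x∈))

⇔-cong : {a a′ b b′ : Fin n} {c c′ d d′ : Fin m} → a ≡ a′ → b ≡ b′ → c ≡ c′ → d ≡ d′ →
  (a < b ⇔ c < d) → (a′ < b′ ⇔ c′ < d′)
⇔-cong refl refl refl refl h = h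

reverse-contains : (w : Vec (Fin n) n) (p : Pattern) → Contains w p → Contains (reverse w) (p ʳ)
reverse-contains {n} w (pat k s X Y) (i , inc , iso , j , jinc , values⊆ , values⊇ , adjX , adjY) =
  mirror i , mirror-increasing i inc ,
  (λ a b → ⇔-cong (wi a) (wi b) (sym (lookup-reverse s a)) (sym (lookup-reverse s b))
                  (iso (opposite a) (opposite b))) ,
  j , jinc ,
  (λ a → let (c , eq) = values⊆ (opposite a) in c , trans eq (wi a)) ,
  (λ c → let (a , eq) = values⊇ c in opposite a ,
    trans eq (trans (cong (λ z → lookup w (i z)) (sym (FP.opposite-involutive a))) (wi (opposite a)))) ,
  adjacent-mirror n i X adjX , adjY
  where
  wi : ∀ a → lookup w (i (opposite a)) ≡ lookup (reverse w) (mirror i a)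
  wi a = sym (lookup-reverse-opposite w (i (opposite a)))

complement-contains : (w : Vec (Fin n) n) (p : Pattern) → Contains w p → Contains (map opposite w) (p ᶜ)
complement-contains {n} w (pat k s X Y) (i , inc , iso , j , jinc , values⊆ , values⊇ , adjX , adjY) =
  i , inc ,
  (λ a b → ⇔-cong (wi a) (wi b) (sym (lookup-map a opposite s)) (sym (lookup-map b opposite s))
    (mk⇔ (λ h → opposite-< (Equivalence.to (iso b a) (opposite-<⁻ h)))
         (λ h → opposite-< (Equivalence.from (iso b a) (opposite-<⁻ h))))) ,
  mirror j , mirror-increasing j jinc ,
  (λ a → let (c , eq) = values⊆ a in opposite c ,
    trans (cong (λ z → opposite (j z)) (FP.opposite-involutive c)) (trans (cong opposite eq) (wi a))) ,
  (λ c → let (a , eq) = values⊇ (opposite c) in a , trans (cong opposite eq) (wi a)) ,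
  adjX , adjacent-mirror n j Y adjY
  where
  wi : ∀ a → opposite (lookup w (i a)) ≡ lookup (map opposite w) (i a)
  wi a = sym (lookup-map (i a) opposite w)

transfer : (Φ : ∀ {n} → Vec (Fin n) n → Vec (Fin n) n) (ψ : Pattern → Pattern) →
  (∀ {n} (w : Vec (Fin n) n) → Φ (Φ w) ≡ w) → (∀ p → ψ (ψ p) ≡ p) →
  (∀ {n} (w : Vec (Fin n) n) → IsPerm w → IsPerm (Φ w)) →
  (∀ {n} (w : Vec (Fin n) n) p → Contains w p → Contains (Φ w) (ψ p)) →
  ∀ p {n c} → NumAvoiders n p c → NumAvoiders n (ψ p) c
transfer Φ ψ Φ-inv ψ-inv Φ-perm Φ-contains p (f , valid , injective , onto) =
  (λ a → Φ (f a)) ,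
  (λ a → Φ-perm (f a) (proj₁ (valid a)) , avoids (f a) (proj₂ (valid a))) ,
  (λ a b eq → injective a b (trans (sym (Φ-inv (f a))) (trans (cong Φ eq) (Φ-inv (f b))))) ,
  (λ w w-perm w-avoids →
     let (a , eq) = onto (Φ w) (Φ-perm w w-perm) (avoids′ w w-avoids)
     in a , trans (cong Φ eq) (Φ-inv w))
  where
  avoids : ∀ w → Avoids w p → Avoids (Φ w) (ψ p)
  avoids w w-avoids h = w-avoids (subst₂ Contains (Φ-inv w) (ψ-inv p) (Φ-contains _ _ h))
  avoids′ : ∀ w → Avoids w (ψ p) → Avoids (Φ w) p
  avoids′ w w-avoids h = w-avoids (subst (λ z → Contains z (ψ p)) (Φ-inv w) (Φ-contains _ _ h))

reversal-preserves : ∀ p {n c} → NumAvoiders n p c → NumAvoiders n (p ʳ) c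
reversal-preserves = transfer reverse _ʳ reverse-involutive ʳ-involutive reverse-perm reverse-contains
  where
  ʳ-involutive : ∀ p → (p ʳ) ʳ ≡ p
  ʳ-involutive (pat k s X Y) = cong₂ (λ a b → pat k a b Y) (reverse-involutive s) (reverse-involutive X)
  reverse-perm : ∀ {n} (w : Vec (Fin n) n) → IsPerm w → IsPerm (reverse w)
  reverse-perm w w-perm a b eq =
    opposite-injective (w-perm _ _ (trans (sym (lookup-reverse w a)) (trans eq (lookup-reverse w b))))

complement-preserves : ∀ p {n c} → NumAvoiders n p c → NumAvoiders n (p ᶜ) c
complement-preserves =
  transfer (map opposite) _ᶜ map-opposite-involutive ᶜ-involutive complement-perm complement-contains
  where
  ᶜ-involutive : ∀ p → (p ᶜ) ᶜ ≡ p
  ᶜ-involutive (pat k s X Y) =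
    cong₂ (λ a b → pat k a X b) (map-opposite-involutive s) (reverse-involutive Y)
  complement-perm : ∀ {n} (w : Vec (Fin n) n) → IsPerm w → IsPerm (map opposite w)
  complement-perm w w-perm a b eq =
    w-perm a b (opposite-injective
      (trans (sym (lookup-map a opposite w)) (trans eq (lookup-map b opposite w))))

-- (3) Enumerating permutations; the counting lemma

Inj : {B : Set} → (A → B) → Set
Inj {A} f = ∀ (a b : A) → f a ≡ f b → a ≡ b

-- the permutation of [m+1] with first letter v whose remaining letters are
-- order-isomorphic to τ: the letters of τ are lifted past v
cons : Fin (suc m) → Vec (Fin m) m → Vec (Fin (suc m)) (suc m)
cons v τ = v ∷ map (punchIn v) τ

cons-perm : (v : Fin (suc m)) (τ : Vec (Fin m) m) → IsPerm τ → IsPerm (cons v τ)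
cons-perm v τ τ-perm zero    zero    eq = refl
cons-perm v τ τ-perm zero    (suc b) eq =
  ⊥-elim (FP.punchInᵢ≢i v (lookup τ b) (sym (trans eq (lookup-map b (punchIn v) τ))))
cons-perm v τ τ-perm (suc a) zero    eq =
  ⊥-elim (FP.punchInᵢ≢i v (lookup τ a) (trans (sym (lookup-map a (punchIn v) τ)) eq))
cons-perm v τ τ-perm (suc a) (suc b) eq = cong suc (τ-perm a b (FP.punchIn-injective v _ _
  (trans (sym (lookup-map a (punchIn v) τ)) (trans eq (lookup-map b (punchIn v) τ)))))

cons-injective : (v v′ : Fin (suc m)) (τ τ′ : Vec (Fin m) m) →
  cons v τ ≡ cons v′ τ′ → v ≡ v′ × τ ≡ τ′
cons-injective {m} v v′ τ τ′ eq with cong head eq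
... | refl = refl , lifted (cong tail eq)
  where
  lifted : ∀ {k} {σ σ′ : Vec (Fin m) k} → map (punchIn v) σ ≡ map (punchIn v) σ′ → σ ≡ σ′
  lifted {σ = []}    {[]}     _  = refl
  lifted {σ = x ∷ σ} {y ∷ σ′} eq =
    cong₂ _∷_ (FP.punchIn-injective v x y (cong head eq)) (lifted (cong tail eq))

uncons : (w : Vec (Fin (suc m)) (suc m)) → IsPerm w →
  Σ (Vec (Fin m) m) λ τ → IsPerm τ × w ≡ cons (lookup w zero) τ
uncons (v ∷ ws) w-perm = τ , τ-perm ,
  cong (v ∷_) (vec-ext _ _ λ a → sym (begin
    lookup (map (punchIn v) τ) a     ≡⟨ lookup-map a (punchIn v) τ ⟩
    punchIn v (lookup τ a)           ≡⟨ cong (punchIn v) (lookup∘tabulate _ a) ⟩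
    punchIn v (punchOut (v≢ a))      ≡⟨ FP.punchIn-punchOut (v≢ a) ⟩
    lookup ws a                      ∎))
  where
  open ≡-Reasoning
  v≢ : ∀ a → v ≢ lookup ws a
  v≢ a eq with w-perm zero (suc a) eq
  ... | ()
  τ : Vec _ _
  τ = tabulate λ a → punchOut (v≢ a)
  τ-perm : IsPerm τ
  τ-perm a b eq = FP.suc-injective (w-perm (suc a) (suc b) (FP.punchOut-injective (v≢ a) (v≢ b)
    (trans (sym (lookup∘tabulate _ a)) (trans eq (lookup∘tabulate _ b)))))

withFirstLetter : (Fin k → Fin (suc m)) → (Fin (m !) → Vec (Fin m) m) →
  Fin (k * m !) → Vec (Fin (suc m)) (suc m)
withFirstLetter {k} {m} g e c = cons (g (proj₁ (remQuot {k} (m !) c))) (e (proj₂ (remQuot {k} (m !) c)))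

withFirstLetter-perm : (g : Fin k → Fin (suc m)) (e : Fin (m !) → Vec (Fin m) m) →
  (∀ t → IsPerm (e t)) → ∀ c → IsPerm (withFirstLetter g e c)
withFirstLetter-perm g e e-perm c = cons-perm _ _ (e-perm _)

withFirstLetter-injective : (g : Fin k → Fin (suc m)) (e : Fin (m !) → Vec (Fin m) m) →
  Inj g → Inj e → Inj (withFirstLetter g e)
withFirstLetter-injective {k} {m} g e g-inj e-inj c c′ eq =
  let (same-first , same-rest) = cons-injective _ _ _ _ eq in begin
  c                                             ≡⟨ FP.combine-remQuot {k} (m !) c ⟨
  combine (proj₁ (rq c)) (proj₂ (rq c))         ≡⟨ cong₂ combine (g-inj _ _ same-first) (e-inj _ _ same-rest) ⟩
  combine (proj₁ (rq c′)) (proj₂ (rq c′))       ≡⟨ FP.combine-remQuot {k} (m !) c′ ⟩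
  c′                                            ∎
  where
  open ≡-Reasoning
  rq = remQuot {k} (m !)

withFirstLetter-onto : (g : Fin k → Fin (suc m)) (e : Fin (m !) → Vec (Fin m) m) →
  (∀ τ → IsPerm τ → ∃ λ t → e t ≡ τ) →
  ∀ w → IsPerm w → (v : Fin k) → lookup w zero ≡ g v → ∃ λ c → withFirstLetter g e c ≡ w
withFirstLetter-onto {k} {m} g e e-onto w w-perm v first
  with τ , τ-perm , w≡ ← uncons w w-perm
  with t , et≡τ ← e-onto τ τ-perm = combine v t , (begin
  withFirstLetter g e (combine v t)   ≡⟨ cong₂ (λ x y → cons (g (proj₁ x)) (e (proj₂ y))) split split ⟩
  cons (g v) (e t)                    ≡⟨ cong₂ cons (sym first) et≡τ ⟩
  cons (lookup w zero) τ              ≡⟨ w≡ ⟨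
  w                                   ∎)
  where
  open ≡-Reasoning
  split = FP.remQuot-combine {k} {m !} v t

allPerms : ∀ m → Fin (m !) → Vec (Fin m) m
allPerms zero    _ = []
allPerms (suc m)   = withFirstLetter (λ v → v) (allPerms m)

allPerms-perm : ∀ m c → IsPerm (allPerms m c)
allPerms-perm zero    c ()
allPerms-perm (suc m) c = withFirstLetter-perm (λ v → v) (allPerms m) (allPerms-perm m) c

allPerms-injective : ∀ m → Inj (allPerms m)
allPerms-injective zero    zero zero _ = refl
allPerms-injective (suc m) =
  withFirstLetter-injective (λ v → v) (allPerms m) (λ _ _ eq → eq) (allPerms-injective m)

allPerms-onto : ∀ m (w : Vec (Fin m) m) → IsPerm w → ∃ λ c → allPerms m c ≡ w
allPerms-onto zero    []  _      = zero , refl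
allPerms-onto (suc m) w w-perm =
  withFirstLetter-onto (λ v → v) (allPerms m) (allPerms-onto m) w w-perm (lookup w zero) refl

N : ℕ → ℕ
N m = suc m ! ∸ m ! + 1

countByFirstLetter : ∀ m p (S : Vec (Fin (suc m)) (suc m)) →
  IsPerm S → lookup S zero ≡ zero → Avoids S p →
  (∀ w → lookup w zero ≢ zero → Avoids w p) →
  (∀ w → IsPerm w → lookup w zero ≡ zero → Avoids w p → w ≡ S) →
  NumAvoiders (suc m) p (N m)
countByFirstLetter m p S S-perm S-first S-avoids others-avoid S-unique =
  subst (NumAvoiders (suc m) p) size (enum , valid , injective , onto)
  where
  others : Fin (m * m !) → Vec (Fin (suc m)) (suc m)
  others = withFirstLetter suc (allPerms m)

  enum : Fin (suc (m * m !)) → Vec (Fin (suc m)) (suc m)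
  enum zero    = S
  enum (suc c) = others c

  valid : ∀ a → IsPerm (enum a) × Avoids (enum a) p
  valid zero    = S-perm , S-avoids
  valid (suc c) = withFirstLetter-perm suc (allPerms m) (allPerms-perm m) c , others-avoid (others c) (λ ())

  injective : Inj enum
  injective zero    zero     _  = refl
  injective zero    (suc c′) eq with trans (sym S-first) (cong (λ w → lookup w zero) eq)
  ... | ()
  injective (suc c) zero     eq with trans (cong (λ w → lookup w zero) eq) S-first
  ... | ()
  injective (suc c) (suc c′) eq =
    cong suc (withFirstLetter-injective suc (allPerms m) (λ _ _ → FP.suc-injective)
                                        (allPerms-injective m) c c′ eq)

  onto : ∀ w → IsPerm w → Avoids w p → ∃ λ a → enum a ≡ w
  onto w w-perm w-avoids with lookup w zero in first
  ... | zero  = zero , sym (S-unique w w-perm first w-avoids)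
  ... | suc v =
    let (c , eq) = withFirstLetter-onto suc (allPerms m) (allPerms-onto m) w w-perm v first in suc c , eq

  size : suc (m * m !) ≡ N m
  size = trans (ℕP.+-comm 1 (m * m !)) (cong (_+ 1) (sym (ℕP.m+n∸m≡n (m !) (m * m !))))

-- (4) Adjacent ascents and descents of maps on Fin (suc m).
-- Consecutive positions of Fin (suc m) are written inject₁ q and suc q, with q : Fin m.

Positive : Fin n → Set
Positive x = 0 ℕ.< toℕ x

consecutive : (q : Fin m) → inject₁ q < suc q
consecutive q = FP.≤̄⇒inject₁< FP.≤-refl

rise-from-start : (f : Fin (suc k) → ℕ) → (∀ q → f (inject₁ q) ℕ.< f (suc q)) →
  ∀ x → toℕ x + f zero ℕ.≤ f x
rise-from-start f asc zero = ℕP.≤-refl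
rise-from-start {suc k} f asc (suc x) = begin
  suc (toℕ x) + f zero   ≡⟨ ℕP.+-suc (toℕ x) (f zero) ⟨
  toℕ x + suc (f zero)   ≤⟨ ℕP.+-monoʳ-≤ (toℕ x) (asc zero) ⟩
  toℕ x + f (suc zero)   ≤⟨ rise-from-start (λ y → f (suc y)) (λ q → asc (suc q)) x ⟩
  f (suc x)              ∎
  where open ℕP.≤-Reasoning

rise-to-end : (f : Fin (suc k) → ℕ) → (∀ q → f (inject₁ q) ℕ.< f (suc q)) →
  ∀ x → f x + (k ∸ toℕ x) ℕ.≤ f (fromℕ k)
rise-to-end {k} f asc zero =
  subst (ℕ._≤ f (fromℕ k)) (trans (cong (_+ f zero) (FP.toℕ-fromℕ k)) (ℕP.+-comm k (f zero)))
    (rise-from-start f asc (fromℕ k))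
rise-to-end {suc k} f asc (suc x) = rise-to-end (λ y → f (suc y)) (λ q → asc (suc q)) x

ascending⇒identity : (f : Fin (suc m) → Fin (suc m)) → (∀ q → f (inject₁ q) < f (suc q)) →
  ∀ x → f x ≡ x
ascending⇒identity {m} f asc x = FP.toℕ-injective (ℕP.≤-antisym upper lower)
  where
  open ℕP.≤-Reasoning
  F : Fin (suc m) → ℕ
  F y = toℕ (f y)
  lower : toℕ x ℕ.≤ F x
  lower = ℕP.≤-trans (ℕP.m≤m+n (toℕ x) (F zero)) (rise-from-start F asc x)
  upper : F x ℕ.≤ toℕ x
  upper = ℕP.+-cancelʳ-≤ (m ∸ toℕ x) (F x) (toℕ x) (begin
    F x + (m ∸ toℕ x)    ≤⟨ rise-to-end F asc x ⟩
    F (fromℕ m)          ≤⟨ FP.toℕ≤pred[n] (f (fromℕ m)) ⟩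
    m                    ≡⟨ ℕP.m+[n∸m]≡n (FP.toℕ≤pred[n] x) ⟨
    toℕ x + (m ∸ toℕ x)  ∎)

descentOrIdentity : (f : Fin (suc m) → Fin (suc m)) → Inj f →
  (∃ λ q → f (suc q) < f (inject₁ q)) ⊎ (∀ x → f x ≡ x)
descentOrIdentity f f-inj with FP.any? (λ q → f (suc q) FP.<? f (inject₁ q))
... | yes descent   = inj₁ descent
... | no no-descent = inj₂ (ascending⇒identity f ascent)
  where
  ascent : ∀ q → f (inject₁ q) < f (suc q)
  ascent q with FP.<-cmp (f (inject₁ q)) (f (suc q))
  ... | tri< lt _ _ = lt
  ... | tri≈ _ eq _ = ⊥-elim (FP.<-irrefl (f-inj _ _ eq) (consecutive q))
  ... | tri> _ _ gt = ⊥-elim (no-descent (q , gt))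

-- when f(0) = 0, nothing lies below f(0), so no descent starts at position 0
descent-after-start : (f : Fin (suc m) → Fin (suc m)) → f zero ≡ zero →
  (q : Fin m) → f (suc q) < f (inject₁ q) → Positive (inject₁ q)
descent-after-start f f0 zero    lt =
  ⊥-elim (ℕP.n≮0 (subst (λ z → toℕ (f (suc zero)) ℕ.< toℕ z) f0 lt))
descent-after-start f f0 (suc q) lt = s≤s z≤n

positive-value : (f : Fin (suc m) → Fin (suc m)) → f zero ≡ zero → Inj f →
  ∀ {x} → Positive x → Positive (f x)
positive-value f f0 f-inj {x} 0<x with f x in fx
... | zero  = ⊥-elim (FP.<-irrefl (sym (f-inj x zero (trans fx (sym f0)))) 0<x)
... | suc _ = s≤s z≤n

-- 0 ↦ 0 and x ↦ m+1−x otherwise (0-based); its one-line word is 1 (m+1) m ⋯ 2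
flipTail : Fin (suc m) → Fin (suc m)
flipTail zero    = zero
flipTail (suc a) = suc (opposite a)

flipTail-involutive : (x : Fin (suc m)) → flipTail (flipTail x) ≡ x
flipTail-involutive zero    = refl
flipTail-involutive (suc a) = cong suc (FP.opposite-involutive a)

flipTail-antitone : {a b : Fin (suc m)} → Positive a → Positive b → flipTail a < flipTail b → b < a
flipTail-antitone {a = suc a} {suc b} _ _ (s≤s lt) = s≤s (opposite-<⁻ lt)

flipTail-injective : {a b : Fin (suc m)} → flipTail a ≡ flipTail b → a ≡ b
flipTail-injective {a = a} {b} eq =
  trans (sym (flipTail-involutive a)) (trans (cong flipTail eq) (flipTail-involutive b))

-- an injective map fixing 0 has an adjacent ascent after position 0 or is flipTail:
-- apply `descentOrIdentity` to flipTail ∘ f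
ascentOrFlipTail : (f : Fin (suc m) → Fin (suc m)) → f zero ≡ zero → Inj f →
  (∃ λ q → Positive (inject₁ q) × f (inject₁ q) < f (suc q)) ⊎ (∀ x → f x ≡ flipTail x)
ascentOrFlipTail f f0 f-inj
  with descentOrIdentity (λ x → flipTail (f x)) (λ a b eq → f-inj a b (flipTail-injective eq))
... | inj₁ (q , lt) =
  inj₁ (q , start ,
        flipTail-antitone (positive-value f f0 f-inj (s≤s z≤n)) (positive-value f f0 f-inj start) lt)
  where
  start : Positive (inject₁ q)
  start = descent-after-start (λ x → flipTail (f x)) (cong flipTail f0) q lt
... | inj₂ g≡id = inj₂ λ x → trans (sym (flipTail-involutive (f x))) (cong flipTail (g≡id x))

-- (5) The six base patterns

triple : Fin n → Fin n → Fin n → Fin 3 → Fin n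
triple x y z zero             = x
triple x y z (suc zero)       = y
triple x y z (suc (suc zero)) = z

triple-increasing : {x y z : Fin n} → x < y → y < z → StrictlyIncreasing (triple x y z)
triple-increasing x<y y<z zero             (suc zero)       _ = x<y
triple-increasing x<y y<z zero             (suc (suc zero)) _ = FP.<-trans x<y y<z
triple-increasing x<y y<z (suc zero)       (suc (suc zero)) _ = y<z
triple-increasing x<y y<z zero             zero             ()
triple-increasing x<y y<z (suc zero)       zero             ()
triple-increasing x<y y<z (suc zero)       (suc zero)       (s≤s ())
triple-increasing x<y y<z (suc (suc zero)) zero             ()
triple-increasing x<y y<z (suc (suc zero)) (suc zero)       (s≤s ())
triple-increasing x<y y<z (suc (suc zero)) (suc (suc zero)) (s≤s (s≤s ()))

increasing-reflects : (j : Fin k → Fin n) → StrictlyIncreasing j → ∀ a b → (j a < j b) ⇔ (a < b)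
increasing-reflects j j-inc a b = mk⇔ reflects (j-inc a b)
  where
  reflects : j a < j b → a < b
  reflects lt with FP.<-cmp a b
  ... | tri< a<b _ _ = a<b
  ... | tri≈ _ refl _ = ⊥-elim (FP.<-irrefl refl lt)
  ... | tri> _ _ b<a = ⊥-elim (FP.<-asym lt (j-inc b a b<a))

occurrence : (w : Vec (Fin n) n) (s : Vec (Fin k) k) (X Y : Subset (suc k)) (i j : Fin k → Fin n) →
  StrictlyIncreasing i → StrictlyIncreasing j → (∀ a → lookup w (i a) ≡ j (lookup s a)) →
  (∀ c → ∃ λ a → lookup s a ≡ c) → Adjacent X (extended n i) → Adjacent Y (extended n j) →
  Contains w (pat k s X Y)
occurrence w s X Y i j i-inc j-inc w∘i s-onto adjX adjY =
  i , i-inc ,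
  (λ a b → let j-order = increasing-reflects j j-inc (lookup s a) (lookup s b) in
     mk⇔ (λ lt → Equivalence.to j-order (subst₂ _<_ (w∘i a) (w∘i b) lt))
         (λ lt → subst₂ _<_ (sym (w∘i a)) (sym (w∘i b)) (Equivalence.from j-order lt))) ,
  j , j-inc ,
  (λ a → lookup s a , sym (w∘i a)) ,
  (λ c → let (a , sa≡c) = s-onto c in a , trans (cong j (sym sa≡c)) (sym (w∘i a))) ,
  adjX , adjY

after-first : (i : Fin (suc k) → Fin n) → StrictlyIncreasing i →
  {a : Fin (suc k)} → Positive a → Positive (i a)
after-first i i-inc {a} 0<a = ℕP.≤-trans (s≤s z≤n) (i-inc zero a 0<a)

anchored-first : (Z : Subset (suc (suc k))) (f : Fin (suc k) → Fin (suc n)) →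
  zero ∈ Z → Adjacent Z (extended (suc n) f) → f zero ≡ zero
anchored-first Z f 0∈Z adj = FP.toℕ-injective (ℕP.suc-injective (adj zero 0∈Z))

-- An occurrence of a pattern that starts with its minimum and is anchored at the
-- first position (0 ∈ X) and at the smallest value (0 ∈ Y) uses π(1) = 1: the
-- smallest value j₀ = 0 is taken at i₀ = 0, or else below the value π(i₀).
anchored-start : (s : Vec (Fin (suc k)) (suc k)) (X Y : Subset (suc (suc k))) → zero ∈ X → zero ∈ Y →
  (∀ a → Positive a → lookup s zero < lookup s a) →
  (w : Vec (Fin (suc m)) (suc m)) → lookup w zero ≢ zero → Avoids w (pat (suc k) s X Y)
anchored-start s X Y 0∈X 0∈Y s-min w w0≢0 (i , i-inc , iso , j , j-inc , _ , values⊇ , adjX , adjY)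
  with values⊇ zero
... | zero , j0≡ =
  w0≢0 (trans (cong (lookup w) (sym (anchored-first X i 0∈X adjX))) (trans (sym j0≡) (anchored-first Y j 0∈Y adjY)))
... | suc a , j0≡ =
  ℕP.n≮0 (subst (λ z → toℕ (lookup w (i zero)) ℕ.< toℕ z) (trans (sym j0≡) (anchored-first Y j 0∈Y adjY))
                (Equivalence.from (iso zero (suc a)) (s-min (suc a) (s≤s z≤n))))

flipTailWord : ∀ m → Vec (Fin (suc m)) (suc m)
flipTailWord m = tabulate flipTail

flipTailWord-perm : IsPerm (flipTailWord m)
flipTailWord-perm a b eq =
  flipTail-injective (trans (sym (lookup∘tabulate flipTail a)) (trans eq (lookup∘tabulate flipTail b)))

identity-perm : IsPerm (allFin n)
identity-perm a b eq = trans (sym (lookup-allFin a)) (trans eq (lookup-allFin b))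

-- 1 (m+1) ⋯ 2 is decreasing after its first letter, so it avoids every
-- pattern with an ascent after the first position
flipTailWord-avoids : (s : Vec (Fin (suc k)) (suc k)) (X Y : Subset (suc (suc k))) (a b : Fin (suc k)) →
  Positive a → a < b → lookup s a < lookup s b → Avoids (flipTailWord m) (pat (suc k) s X Y)
flipTailWord-avoids s X Y a b 0<a a<b ascent (i , i-inc , iso , _) =
  FP.<-asym (i-inc a b a<b)
    (flipTail-antitone (after-first i i-inc 0<a) (after-first i i-inc (ℕP.<-trans 0<a a<b))
      (subst₂ _<_ (lookup∘tabulate flipTail (i a)) (lookup∘tabulate flipTail (i b))
        (Equivalence.from (iso a b) ascent)))

identity-avoids : (s : Vec (Fin k) k) (X Y : Subset (suc k)) (a b : Fin k) →
  a < b → lookup s b < lookup s a → Avoids (allFin n) (pat k s X Y)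
identity-avoids s X Y a b a<b descent (i , i-inc , iso , _) =
  FP.<-asym (i-inc a b a<b)
    (subst₂ _<_ (lookup-allFin (i b)) (lookup-allFin (i a)) (Equivalence.from (iso b a) descent))

onto-123 : ∀ c → ∃ λ a → lookup w123 a ≡ c
onto-123 zero             = zero , refl
onto-123 (suc zero)       = suc zero , refl
onto-123 (suc (suc zero)) = suc (suc zero) , refl

onto-132 : ∀ c → ∃ λ a → lookup w132 a ≡ c
onto-132 zero             = zero , refl
onto-132 (suc zero)       = suc (suc zero) , refl
onto-132 (suc (suc zero)) = suc zero , refl

min-first-123 : ∀ a → Positive a → lookup w123 zero < lookup w123 a
min-first-123 (suc zero)       _ = s≤s z≤n
min-first-123 (suc (suc zero)) _ = s≤s z≤n

min-first-132 : ∀ a → Positive a → lookup w132 zero < lookup w132 a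
min-first-132 (suc zero)       _ = s≤s z≤n
min-first-132 (suc (suc zero)) _ = s≤s z≤n

anchored-S0 : {y z : Fin (suc n)} → Adjacent S0 (extended (suc n) (triple zero y z))
anchored-S0 zero             here = refl
anchored-S0 (suc zero)       (there ())
anchored-S0 (suc (suc zero)) (there (there ()))
anchored-S0 (suc (suc (suc zero))) (there (there (there ())))

anchored-S02 : (q : Fin n) → Adjacent S02 (extended (suc n) (triple zero (inject₁ q) (suc q)))
anchored-S02 q zero                   here = refl
anchored-S02 q (suc zero)             (there ())
anchored-S02 q (suc (suc zero))       (there (there here)) =
  cong (λ t → suc (suc t)) (sym (FP.toℕ-inject₁ q))
anchored-S02 q (suc (suc (suc zero))) (there (there (there ())))

occurrence-123 : (w : Vec (Fin (suc m)) (suc m)) → IsPerm w → lookup w zero ≡ zero → (X Y : Subset 4) →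
  {a b : Fin (suc m)} → Positive a → a < b → lookup w a < lookup w b →
  Adjacent X (extended (suc m) (triple zero a b)) →
  Adjacent Y (extended (suc m) (triple zero (lookup w a) (lookup w b))) →
  Contains w (pat 3 w123 X Y)
occurrence-123 w w-perm w0 X Y {a} {b} 0<a a<b ascent adjX adjY =
  occurrence w w123 X Y (triple zero a b) (triple zero (lookup w a) (lookup w b))
    (triple-increasing 0<a a<b) (triple-increasing (positive-value (lookup w) w0 w-perm 0<a) ascent)
    (λ { zero → w0 ; (suc zero) → refl ; (suc (suc zero)) → refl }) onto-123 adjX adjY

occurrence-132 : (w : Vec (Fin (suc m)) (suc m)) → IsPerm w → lookup w zero ≡ zero → (X Y : Subset 4) →
  {a b : Fin (suc m)} → Positive a → a < b → lookup w b < lookup w a →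
  Adjacent X (extended (suc m) (triple zero a b)) →
  Adjacent Y (extended (suc m) (triple zero (lookup w b) (lookup w a))) →
  Contains w (pat 3 w132 X Y)
occurrence-132 w w-perm w0 X Y {a} {b} 0<a a<b descent adjX adjY =
  occurrence w w132 X Y (triple zero a b) (triple zero (lookup w b) (lookup w a))
    (triple-increasing 0<a a<b)
    (triple-increasing (positive-value (lookup w) w0 w-perm (ℕP.<-trans 0<a a<b)) descent)
    (λ { zero → w0 ; (suc zero) → refl ; (suc (suc zero)) → refl }) onto-132 adjX adjY

AtConsecutive : Subset 4 → ℕ → Set
AtConsecutive X m = ∀ (q : Fin m) → Adjacent X (extended (suc m) (triple zero (inject₁ q) (suc q)))

-- σ = 123 with such an X: an avoider with π(1) = 1 has no adjacent ascent
-- after its first letter, so it is 1 (m+1) m ⋯ 2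
unique-123-positions : (X : Subset 4) → AtConsecutive X m →
  ∀ w → IsPerm w → lookup w zero ≡ zero → Avoids w (pat 3 w123 X S0) → w ≡ flipTailWord m
unique-123-positions X adjX w w-perm w0 w-avoids with ascentOrFlipTail (lookup w) w0 w-perm
... | inj₁ (q , 0<q , ascent) =
  ⊥-elim (w-avoids (occurrence-123 w w-perm w0 X S0 0<q (consecutive q) ascent (adjX q) anchored-S0))
... | inj₂ w≡flip = vec-ext _ _ λ x → trans (w≡flip x) (sym (lookup∘tabulate flipTail x))

-- σ = 132 likewise: an avoider with π(1) = 1 has no adjacent descent, so it is the identity
unique-132-positions : (X : Subset 4) → AtConsecutive X m →
  ∀ w → IsPerm w → lookup w zero ≡ zero → Avoids w (pat 3 w132 X S0) → w ≡ allFin (suc m)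
unique-132-positions X adjX w w-perm w0 w-avoids with descentOrIdentity (lookup w) w-perm
... | inj₁ (q , descent) = ⊥-elim (w-avoids (occurrence-132 w w-perm w0 X S0
        (descent-after-start (lookup w) w0 q descent) (consecutive q) descent (adjX q) anchored-S0))
... | inj₂ w≡id = vec-ext _ _ λ x → trans (w≡id x) (sym (lookup-allFin x))

injective⇒onto : (f : Fin n → Fin n) → Inj f → ∀ v → ∃ λ a → f a ≡ v
injective⇒onto {suc n} f f-inj v with FP.any? (λ a → f a FP.≟ v)
... | yes hit = hit
... | no miss =
  let (a , b , a<b , eq) = FP.pigeonhole (ℕP.n<1+n n) (λ a → punchOut (missed a))
  in ⊥-elim (FP.<-irrefl (f-inj a b (FP.punchOut-injective (missed a) (missed b) eq)) a<b)
  where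
  missed : ∀ a → v ≢ f a
  missed a eq = miss (a , sym eq)

-- For Y = {0,2} the constraint is on consecutive values: run the positional
-- argument on the map `position` sending each value to its position in π.
module _ {m : ℕ} (w : Vec (Fin (suc m)) (suc m)) (w-perm : IsPerm w) (w0 : lookup w zero ≡ zero) where
  private
    position : Fin (suc m) → Fin (suc m)
    position v = proj₁ (injective⇒onto (lookup w) w-perm v)

    lookup-position : ∀ v → lookup w (position v) ≡ v
    lookup-position v = proj₂ (injective⇒onto (lookup w) w-perm v)

    position-injective : Inj position
    position-injective a b eq =
      trans (sym (lookup-position a)) (trans (cong (lookup w) eq) (lookup-position b))

    position0 : position zero ≡ zero
    position0 = w-perm _ _ (trans (lookup-position zero) (sym w0))

    positive-position : ∀ {v} → Positive v → Positive (position v)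
    positive-position = positive-value position position0 position-injective

    consecutive-values : (q : Fin m) →
      Adjacent S02 (extended (suc m)
        (triple zero (lookup w (position (inject₁ q))) (lookup w (position (suc q)))))
    consecutive-values q = subst₂ (λ y z → Adjacent S02 (extended (suc m) (triple zero y z)))
      (sym (lookup-position _)) (sym (lookup-position _)) (anchored-S02 q)

    ordered-values : (q : Fin m) → lookup w (position (inject₁ q)) < lookup w (position (suc q))
    ordered-values q = subst₂ _<_ (sym (lookup-position _)) (sym (lookup-position _)) (consecutive q)

  unique-p₂ : Avoids w p₂ → w ≡ flipTailWord m
  unique-p₂ w-avoids with ascentOrFlipTail position position0 position-injective
  ... | inj₁ (q , 0<q , ascent) = ⊥-elim (w-avoids (occurrence-123 w w-perm w0 S0 S02
          (positive-position 0<q) ascent (ordered-values q) anchored-S0 (consecutive-values q)))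
  ... | inj₂ position≡flip = vec-ext _ _ λ x → begin
    lookup w x
      ≡⟨ cong (lookup w) (trans (sym (flipTail-involutive x)) (sym (position≡flip (flipTail x)))) ⟩
    lookup w (position (flipTail x))  ≡⟨ lookup-position (flipTail x) ⟩
    flipTail x                        ≡⟨ lookup∘tabulate flipTail x ⟨
    lookup (flipTailWord m) x         ∎
    where open ≡-Reasoning

  unique-p₄ : Avoids w p₄ → w ≡ allFin (suc m)
  unique-p₄ w-avoids with descentOrIdentity position position-injective
  ... | inj₁ (q , descent) = ⊥-elim (w-avoids (occurrence-132 w w-perm w0 S0 S02
          (positive-position (s≤s z≤n)) descent (ordered-values q) anchored-S0 (consecutive-values q)))
  ... | inj₂ position≡id = vec-ext _ _ λ x →
    trans (cong (lookup w) (sym (position≡id x))) (trans (lookup-position x) (sym (lookup-allFin x)))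

count-123 : ∀ m (X Y : Subset 4) → zero ∈ X → zero ∈ Y →
  (∀ w → IsPerm w → lookup w zero ≡ zero → Avoids w (pat 3 w123 X Y) → w ≡ flipTailWord m) →
  NumAvoiders (suc m) (pat 3 w123 X Y) (N m)
count-123 m X Y 0∈X 0∈Y =
  countByFirstLetter m (pat 3 w123 X Y) (flipTailWord m) flipTailWord-perm refl
    (flipTailWord-avoids w123 X Y (suc zero) (suc (suc zero)) (s≤s z≤n) (s≤s (s≤s z≤n)) (s≤s (s≤s z≤n)))
    (anchored-start w123 X Y 0∈X 0∈Y min-first-123)

count-132 : ∀ m (X Y : Subset 4) → zero ∈ X → zero ∈ Y →
  (∀ w → IsPerm w → lookup w zero ≡ zero → Avoids w (pat 3 w132 X Y) → w ≡ allFin (suc m)) →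
  NumAvoiders (suc m) (pat 3 w132 X Y) (N m)
count-132 m X Y 0∈X 0∈Y =
  countByFirstLetter m (pat 3 w132 X Y) (allFin (suc m)) identity-perm refl
    (identity-avoids w132 X Y (suc zero) (suc (suc zero)) (s≤s (s≤s z≤n)) (s≤s (s≤s z≤n)))
    (anchored-start w132 X Y 0∈X 0∈Y min-first-132)

-- the six base counts (p₂ⁱ and p₄ⁱ compute to (123,{0,2},{0}) and (132,{0,2},{0}))
count-p₁ : ∀ m → NumAvoiders (suc m) p₁ (N m)
count-p₁ m = count-123 m S0 S0 here here (unique-123-positions S0 (λ _ → anchored-S0))

count-p₂ : ∀ m → NumAvoiders (suc m) p₂ (N m)
count-p₂ m = count-123 m S0 S02 here here unique-p₂

count-p₂ⁱ : ∀ m → NumAvoiders (suc m) (p₂ ⁱ) (N m)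
count-p₂ⁱ m = count-123 m S02 S0 here here (unique-123-positions S02 anchored-S02)

count-p₃ : ∀ m → NumAvoiders (suc m) p₃ (N m)
count-p₃ m = count-132 m S0 S0 here here (unique-132-positions S0 (λ _ → anchored-S0))

count-p₄ : ∀ m → NumAvoiders (suc m) p₄ (N m)
count-p₄ m = count-132 m S0 S02 here here unique-p₄

count-p₄ⁱ : ∀ m → NumAvoiders (suc m) (p₄ ⁱ) (N m)
count-p₄ⁱ m = count-132 m S02 S0 here here (unique-132-positions S02 anchored-S02)

-- (6) The symmetry class

_≟ₚ_ : DecidableEquality Pattern
pat k s X Y ≟ₚ pat k′ s′ X′ Y′ with k ℕ.≟ k′
... | no k≢k′ = no λ eq → k≢k′ (cong len eq)
... | yes refl = map′ (λ { (refl , refl , refl) → refl }) (λ { refl → refl , refl , refl })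
  (≡-dec FP._≟_ s s′ ×-dec ≡-dec Bool._≟_ X X′ ×-dec ≡-dec Bool._≟_ Y Y′)

-- Only r and c are shown to preserve avoider counts, so the inverses p₂ⁱ and
-- p₄ⁱ (p₁ and p₃ are their own inverses) are counted directly as extra bases.
bases : List Pattern
bases = p₁ ∷ p₂ ∷ p₂ ⁱ ∷ p₃ ∷ p₄ ∷ p₄ ⁱ ∷ []

symmetries : List (Pattern → Pattern)
symmetries = (λ q → q) ∷ _ʳ ∷ _ᶜ ∷ (λ q → (q ʳ) ᶜ) ∷ []

orbit : List Pattern
orbit = cartesianProductWith (λ b s → s b) bases symmetries

ClosedAt : Pattern → Set
ClosedAt q = q ⁱ ∈ₗ orbit × q ʳ ∈ₗ orbit × q ᶜ ∈ₗ orbit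

closedAt? : ∀ q → Dec (ClosedAt q)
closedAt? q = any? (q ⁱ ≟ₚ_) orbit ×-dec any? (q ʳ ≟ₚ_) orbit ×-dec any? (q ᶜ ≟ₚ_) orbit

orbit-closed : All ClosedAt orbit
orbit-closed = toWitness {a? = all? closedAt? orbit} tt

base∈orbit : ∀ {b} → b ∈ₗ bases → b ∈ₗ orbit
base∈orbit b∈ = ∈-cartesianProductWith⁺ (λ b s → s b) {ys = symmetries} {b = λ q → q} b∈ (here refl)

class⊆orbit : ∀ {p₀ q} → p₀ ∈ₗ orbit → InSymClass p₀ q → q ∈ₗ orbit
class⊆orbit p₀∈ base    = p₀∈
class⊆orbit p₀∈ (byI h) = proj₁ (All.lookup orbit-closed (class⊆orbit p₀∈ h))
class⊆orbit p₀∈ (byR h) = proj₁ (proj₂ (All.lookup orbit-closed (class⊆orbit p₀∈ h)))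
class⊆orbit p₀∈ (byC h) = proj₂ (proj₂ (All.lookup orbit-closed (class⊆orbit p₀∈ h)))

orbit-counts : ∀ {q} → q ∈ₗ orbit → ∀ m → NumAvoiders (suc m) q (N m)
orbit-counts q∈ m
  with b , s , b∈ , s∈ , refl ← ∈-cartesianProductWith⁻ (λ b s → s b) bases symmetries q∈ =
  All.lookup preserve s∈ b (All.lookup counted b∈ m)
  where
  counted : All (λ b → ∀ m → NumAvoiders (suc m) b (N m)) bases
  counted = count-p₁ ∷ count-p₂ ∷ count-p₂ⁱ ∷ count-p₃ ∷ count-p₄ ∷ count-p₄ⁱ ∷ []
  preserve : All (λ s → ∀ q {n c} → NumAvoiders n q c → NumAvoiders n (s q) c) symmetries
  preserve = (λ q h → h) ∷ reversal-preserves ∷ complement-preserves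
           ∷ (λ q h → complement-preserves (q ʳ) (reversal-preserves q h)) ∷ []

mainTheorem14 : ∀ (p : Pattern) →
    (InSymClass p₁ p ⊎ InSymClass p₂ p ⊎ InSymClass p₃ p ⊎ InSymClass p₄ p) →
    ∀ (m : ℕ) → NumAvoiders (suc m) p ((suc m) ! ∸ m ! + 1)
mainTheorem14 p (inj₁ h)               = orbit-counts (class⊆orbit (base∈orbit (here refl)) h)
mainTheorem14 p (inj₂ (inj₁ h))        = orbit-counts (class⊆orbit (base∈orbit (there (here refl))) h)
mainTheorem14 p (inj₂ (inj₂ (inj₁ h))) =
  orbit-counts (class⊆orbit (base∈orbit (there (there (there (here refl))))) h)
mainTheorem14 p (inj₂ (inj₂ (inj₂ h))) =
  orbit-counts (class⊆orbit (base∈orbit (there (there (there (there (here refl)))))) h)
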